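{- The two-party function $\mathrm{VER}\colon\mathbb{Z}_4\times\mathbb{Z}_4\to\{0,1\}$ defined by $\mathrm{VER}(x,y)=1$ iff $x+y\in\{2,3\}$ (arithmetic in $\mathbb{Z}_4$) is versatile.
   Context: For two-party functions $f_i\colon\mathcal{X}_i\times\mathcal{Y}_i\to\{0,1\}$, $f_1\le f_2$ means there are one-to-one maps $\pi_A\colon\mathcal{X}_1\to\mathcal{X}_2$, $\pi_B\colon\mathcal{Y}_1\to\mathcal{Y}_2$ with $f_1(x,y)=f_2(\pi_A(x),\pi_B(y))$ for all $(x,y)$. A function $g$ is flippable if $\neg g\le g$. It is random-self-reducible if there are maps $\pi_A(x,r),\pi_B(y,r)$ and a random variable $\bm r$ such that for each $z\in\{0,1\}$ and each $(x,y)\in g^{ -1}(z)$, the pair $(\pi_A(x,\bm r),\pi_B(y,\bm r))$ is uniformly distributed on $g^{ -1}(z)$. $g$ is versatile if $\mathrm{AND}\le g$ (AND on $\{0,1\}\times\{0,1\}$), $g$ is flippable, and $g$ is random-self-reducible. -}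

module Defs where

open import Data.Bool using (Bool; true; false; not; _∧_)
open import Data.Bool.Properties renaming (_≟_ to _≟ᵇ_)
open import Data.Nat using (ℕ; _+_; _*_; _%_; _≤ᵇ_; _>_)
open import Data.Fin using (Fin; toℕ; _≟_)
open import Data.List using (List; length; filter; cartesianProduct; allFin)
open import Data.Product using (Σ; _×_; _,_; proj₁; proj₂)
open import Relation.Nullary.Decidable using (_×-dec_)
open import Relation.Binary.PropositionalEquality using (_≡_)
open import Function.Definitions using (Injective)

-- A two-party function f : X × Y → {0,1} (curried; Bool plays {0,1}, true = 1).
TwoParty : Set → Set → Set
TwoParty X Y = X → Y → Bool

_≼_ : ∀ {X₁ Y₁ X₂ Y₂ : Set} → TwoParty X₁ Y₁ → TwoParty X₂ Y₂ → Set
_≼_ {X₁} {Y₁} {X₂} {Y₂} f₁ f₂ =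
  Σ (X₁ → X₂) λ πA → Σ (Y₁ → Y₂) λ πB →
    Injective _≡_ _≡_ πA × Injective _≡_ _≡_ πB ×
    (∀ x y → f₁ x y ≡ f₂ (πA x) (πB y))

neg : ∀ {X Y : Set} → TwoParty X Y → TwoParty X Y
neg g x y = not (g x y)

Flippable : ∀ {X Y : Set} → TwoParty X Y → Set
Flippable g = neg g ≼ g

AND : TwoParty Bool Bool
AND a b = a ∧ b

preimageSize : ∀ {m n} → TwoParty (Fin m) (Fin n) → Bool → ℕ
preimageSize {m} {n} g z =
  length (filter (λ p → g (proj₁ p) (proj₂ p) ≟ᵇ z)
                 (cartesianProduct (allFin m) (allFin n)))

-- A (finitely supported, rational-probability) random variable on R is
-- represented by a nonempty list of outcomes, each entry having equal weight.
hits : ∀ {m n} {R : Set} → (Fin m → R → Fin m) → (Fin n → R → Fin n) →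
       List R → Fin m → Fin n → Fin m → Fin n → ℕ
hits πA πB rs x y a b =
  length (filter (λ r → (πA x r ≟ a) ×-dec (πB y r ≟ b)) rs)

-- Random self-reducibility: for each z and (x,y) ∈ g⁻¹(z), the pair
-- (πA(x,r), πB(y,r)) is uniform on g⁻¹(z): every (a,b) ∈ g⁻¹(z) has
-- probability 1/|g⁻¹(z)|, i.e. hits · |g⁻¹(z)| = |rs|.
RandomSelfReducible : ∀ {m n} → TwoParty (Fin m) (Fin n) → Set₁
RandomSelfReducible {m} {n} g =
  Σ Set λ R → Σ (List R) λ rs →
  Σ (Fin m → R → Fin m) λ πA → Σ (Fin n → R → Fin n) λ πB →
    length rs > 0 ×
    (∀ (z : Bool) (x : Fin m) (y : Fin n) → g x y ≡ z →
      ∀ (a : Fin m) (b : Fin n) → g a b ≡ z →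
        hits πA πB rs x y a b * preimageSize g z ≡ length rs)

Versatile : ∀ {m n} → TwoParty (Fin m) (Fin n) → Set₁
Versatile g = (AND ≼ g) × Flippable g × RandomSelfReducible g

VER : TwoParty (Fin 4) (Fin 4)
VER x y = 2 ≤ᵇ ((toℕ x + toℕ y) % 4)

module Submission where

-- AND ≤ VER: embed the bits 0,1 into ℤ₄ as themselves; x + y ∈ {2,3} for
-- x,y ∈ {0,1} exactly when x = y = 1.
-- Flippability: adding 2 to Alice's input shifts x + y by 2, which swaps
-- {0,1} with {2,3}; x ↦ x + 2 is an involution, hence injective.
-- Random self-reducibility: a sample is an orientation together with a
-- shift r ∈ ℤ₄.  The orientation "keep" sends (x,y) to (x + r, y − r),
-- preserving the sum s = x + y; "reflect" sends (x,y) to (1 − x + r, −y − r),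
-- mapping s to 1 − s, which swaps 0 ↔ 1 and 2 ↔ 3.  Hence for (x,y) and (a,b)
-- with equal VER-value exactly one of the 8 samples carries (x,y) to (a,b),
-- and both fibres of VER have 8 elements, so the image is uniform.

open import Defs
open import Data.Bool using (Bool; true; false)
open import Data.Bool.Properties using () renaming (_≟_ to _≟ᵇ_)
open import Data.Nat as ℕ using (_+_; _∸_; s≤s; z≤n)
open import Data.Nat.Properties using (*-identityˡ)
open import Data.Nat.DivMod using (_mod_)
open import Data.Fin using (Fin; toℕ; #_; _≟_)
open import Data.Fin.Properties using (all?)
open import Data.List using (List; _∷_; []; length; cartesianProduct; allFin)
open import Data.Product using (_×_; _,_)
open import Function.Definitions using (Injective)
open import Relation.Nullary.Decidable using (from-yes; _→-dec_)
open import Relation.Binary.PropositionalEquality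
  using (_≡_; refl; sym; trans; cong)

involution⇒injective : ∀ {A : Set} (f : A → A) →
                       (∀ x → f (f x) ≡ x) → Injective _≡_ _≡_ f
involution⇒injective f inv {a} {b} fa≡fb =
  trans (sym (inv a)) (trans (cong f fa≡fb) (inv b))

exact-hits⇒rsr :
  ∀ {m n} (g : TwoParty (Fin m) (Fin n)) {R : Set} (rs : List R)
  (πA : Fin m → R → Fin m) (πB : Fin n → R → Fin n) →
  length rs ℕ.> 0 →
  (∀ x y a b → g x y ≡ g a b → hits πA πB rs x y a b ≡ 1) →
  (∀ a b → preimageSize g (g a b) ≡ length rs) →
  RandomSelfReducible g
exact-hits⇒rsr g rs πA πB nonempty hit-once fibre-size =
  _ , rs , πA , πB , nonempty , uniform
  where
  uniform : ∀ z x y → g x y ≡ z → ∀ a b → g a b ≡ z →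
            hits πA πB rs x y a b ℕ.* preimageSize g z ≡ length rs
  uniform z x y gxy≡z a b gab≡z
    rewrite hit-once x y a b (trans gxy≡z (sym gab≡z))
          | sym gab≡z
          = trans (*-identityˡ _) (fibre-size a b)

_⊕_ : Fin 4 → Fin 4 → Fin 4
x ⊕ y = (toℕ x + toℕ y) mod 4

_⊖_ : Fin 4 → Fin 4 → Fin 4
x ⊖ y = (toℕ x + (4 ∸ toℕ y)) mod 4

infixl 6 _⊕_ _⊖_

bit : Bool → Fin 4
bit false = # 0
bit true  = # 1

bit-injective : Injective _≡_ _≡_ bit
bit-injective {false} {false} _ = refl
bit-injective {true}  {true}  _ = refl

AND≼VER : AND ≼ VER
AND≼VER = bit , bit , bit-injective , bit-injective , agrees
  where
  agrees : ∀ a b → AND a b ≡ VER (bit a) (bit b)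
  agrees false false = refl
  agrees false true  = refl
  agrees true  false = refl
  agrees true  true  = refl

shift₂ : Fin 4 → Fin 4
shift₂ x = x ⊕ # 2

shift₂-involutive : ∀ x → shift₂ (shift₂ x) ≡ x
shift₂-involutive = from-yes (all? λ x → shift₂ (shift₂ x) ≟ x)

shift₂-negates : ∀ x y → neg VER x y ≡ VER (shift₂ x) y
shift₂-negates =
  from-yes (all? λ x → all? λ y → neg VER x y ≟ᵇ VER (shift₂ x) y)

VER-flippable : Flippable VER
VER-flippable =
  shift₂ , (λ y → y) , involution⇒injective shift₂ shift₂-involutive ,
  (λ eq → eq) , shift₂-negates

data Orientation : Set where
  keep reflect : Orientation

Sample : Set
Sample = Orientation × Fin 4

samples : List Sample
samples = cartesianProduct (keep ∷ reflect ∷ []) (allFin 4)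

-- keep:    (x,y) ↦ (x + r, y − r),        sum s ↦ s
-- reflect: (x,y) ↦ (1 − x + r, −y − r),   sum s ↦ 1 − s
reduceA : Fin 4 → Sample → Fin 4
reduceA x (keep    , r) = x ⊕ r
reduceA x (reflect , r) = # 1 ⊖ x ⊕ r

reduceB : Fin 4 → Sample → Fin 4
reduceB y (keep    , r) = y ⊖ r
reduceB y (reflect , r) = # 0 ⊖ y ⊖ r

reduce-hits-once : ∀ x y a b → VER x y ≡ VER a b →
                   hits reduceA reduceB samples x y a b ≡ 1
reduce-hits-once =
  from-yes (all? λ x → all? λ y → all? λ a → all? λ b →
    (VER x y ≟ᵇ VER a b) →-dec (hits reduceA reduceB samples x y a b ℕ.≟ 1))

VER-fibre-size : ∀ a b → preimageSize VER (VER a b) ≡ length samples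
VER-fibre-size = from-yes (all? λ a → all? λ b →
  preimageSize VER (VER a b) ℕ.≟ length samples)

VER-rsr : RandomSelfReducible VER
VER-rsr = exact-hits⇒rsr VER samples reduceA reduceB (s≤s z≤n)
                         reduce-hits-once VER-fibre-size

lemma1 : Versatile VER
lemma1 = AND≼VER , VER-flippable , VER-rsr
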